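{- Let $\preceq$ be an $n$-ordering system on a set $X$ and let $s\subseteq X$ be finite. Then for every $k\leq\min\{n-1,|s|\}$ there is a unique $s_k\subseteq s$ with $|s_k|=k$ such that $s\setminus s_k\subseteq\mathrm{dom}(\preceq_{s_k})$.
   Context: For $0<n<\omega$, an $n$-ordering system on a set $X$ is a function assigning to each $s\in[X]^{<n}$ (finite subsets of size $<n$) a relation $\preceq_s\subseteq X^2$, defined recursively: a $1$-ordering system is one in which $\preceq_\emptyset$ is a non-strict well-order of $X$; for $n>1$, $\preceq$ is an $n$-ordering system if $\preceq_\emptyset$ is a non-strict well-order of $X$ and for every $x_0\in X$ the function $\preceq^{x_0}$ on $[X_{\prec_\emptyset x_0}]^{<n-1}$ given by $\preceq^{x_0}_t=\preceq_{t\cup\{x_0\}}$ is an $(n-1)$-ordering system on $X_{\prec_\emptyset x_0}=\{x\in X:x\prec_\emptyset x_0\}$. Here $\prec_s$ is $\preceq_s$ minus the diagonal and $\mathrm{dom}(\preceq_s)=\{x\in X:(x,x)\in\preceq_s\}$. -}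

module Defs where

open import Level using (Level; _⊔_)
open import Data.Nat using (ℕ; zero; suc; _<_)
open import Data.Empty using (⊥)
import Data.Unit
open import Data.Product using (_×_; _,_)
open import Data.Sum using (_⊎_)
open import Data.List using (List; []; _∷_; length)
open import Data.List.Relation.Unary.Unique.Propositional using (Unique)
open import Data.List.Relation.Binary.Permutation.Propositional using (_↭_)
open import Relation.Binary.Core using (Rel)
open import Relation.Binary.PropositionalEquality using (_≡_; _≢_)
open import Relation.Unary using (Pred)
open import Induction.WellFounded using (WellFounded)

private
  variable
    a ℓ : Level

module _ {X : Set a} where

  Strict : Rel X ℓ → Rel X (a ⊔ ℓ)
  Strict R x y = R x y × x ≢ y

  Dom : Rel X ℓ → Pred X ℓ
  Dom R x = R x x

  record IsWellOrderOn {d} (D : Pred X d) (R : Rel X ℓ) : Set (a ⊔ d ⊔ ℓ) where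
    field
      inside    : ∀ {x y} → R x y → D x × D y
      refl      : ∀ {x} → D x → R x x
      trans     : ∀ {x y z} → R x y → R y z → R x z
      antisym   : ∀ {x y} → R x y → R y x → x ≡ y
      total     : ∀ {x y} → D x → D y → R x y ⊎ R y x
      wellFound : WellFounded (Strict R)

  -- A finite set s = {x0, x1, ...} is represented by the list x0 ∷ x1 ∷ ...
  -- where x0 is the ≼_∅-maximum, x1 the ≼_{x0}-maximum of the rest, etc.
  -- (≼^{x0}_t = ≼_{t ∪ {x0}} is modelled by  t ↦ R (x0 ∷ t)).
  -- There are no 0-ordering systems (0 < n in the definition).
  IsOS : ∀ {d} → ℕ → Pred X d → (List X → Rel X ℓ) → Set (a ⊔ d ⊔ ℓ)
  IsOS zero          D R = Level.Lift _ ⊥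
  IsOS (suc zero)    D R = IsWellOrderOn D (R [])
  IsOS (suc (suc m)) D R =
    IsWellOrderOn D (R []) ×
    (∀ x₀ → D x₀ →
       IsOS (suc m) (λ x → D x × Strict (R []) x x₀) (λ t → R (x₀ ∷ t)))

  -- An n-ordering system on X: a function on finite subsets of X of size < n
  -- (finite subsets = duplicate-free lists, so the assignment must not
  -- depend on the order in which a set is listed), satisfying the recursion.
  IsOrderingSystem : ∀ {ℓ} → ℕ → (List X → Rel X ℓ) → Set (a ⊔ ℓ)
  IsOrderingSystem {ℓ} n R =
    (∀ s t → Unique s → length s < n → s ↭ t → ∀ x y → R s x y → R t x y) ×
    IsOS n (λ (_ : X) → Data.Unit.⊤) R

{-# OPTIONS --safe #-}
-- Call c = y₀ ∷ y₁ ∷ … a chain if each yᵢ is strictly below yⱼ in ≼_{y₀…yⱼ₋₁} for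
-- all j < i. Unfolding the recursive definition along a chain of length < n shows
-- that ≼_c is a well-order whose domain consists of the x strictly below every yᵢ in
-- ≼_{y₀…yᵢ₋₁}. So a k-element sₖ ⊆ s with s ∖ sₖ ⊆ dom(≼_{sₖ}), listed as a chain,
-- must begin with the ≼_∅-maximum of s, continue with the ≼_{y₀}-maximum of the
-- rest, and so on: this greedy choice exists and is forced. Listing sₖ in chain
-- order is harmless because ≼ does not depend on the order of its argument list.
module Submission where

open import Defs
open import Level using (Level; _⊔_; Lift; lift; lower)
open import Data.Nat using (ℕ; zero; suc; _+_; _≤_; _<_; _∸_; s≤s)
open import Data.Nat.Properties using (suc-injective; ≤-refl; ≤-reflexive; ≤-trans; m+1+n≢m)
open import Data.Product using (Σ; ∃; ∃₂; _×_; _,_; proj₁; proj₂)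
open import Data.Sum using (_⊎_; inj₁; inj₂)
open import Data.Empty using (⊥-elim)
open import Data.Unit using (⊤; tt)
open import Data.List using (List; []; _∷_; length; _++_)
open import Data.List.Properties using (length-++; ++-identityʳ)
open import Data.List.Relation.Unary.Unique.Propositional using (Unique)
open import Data.List.Relation.Unary.AllPairs as AllPairs using ([]; _∷_)
open import Data.List.Relation.Unary.All as All using (All; []; _∷_)
open import Data.List.Relation.Unary.Any using (here; there; toSum; fromSum)
open import Data.List.Relation.Binary.Subset.Propositional using (_⊆_)
open import Data.List.Relation.Binary.Permutation.Propositional
  using (_↭_; ↭-refl; ↭-prep; ↭-swap; ↭-trans; ↭-sym; ↭⇒↭ₛ)
open import Data.List.Relation.Binary.Permutation.Propositional.Properties
  using (∈-resp-↭; ↭-length; All-resp-↭)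
import Data.List.Relation.Binary.Permutation.Setoid.Properties as PermutationSetoid
open import Data.List.Membership.Propositional using (_∈_; _∉_)
open import Data.List.Membership.Propositional.Properties using (∈-++⁻; ∈-++⁺ˡ)
open import Relation.Binary.Core using (Rel)
open import Relation.Binary.Definitions using (Transitive)
open import Relation.Binary.PropositionalEquality
  using (_≡_; refl; sym; trans; cong; subst; ≢-sym; setoid; module ≡-Reasoning)
open import Relation.Nullary using (Dec; yes; no)
open import Relation.Nullary.Decidable using (_⊎-dec_; map′)
open import Relation.Unary using (Pred; U)
open import Function using (_∘_)
open import Function.Bundles using (_⇔_; mk⇔; module Equivalence)

module _ {a ℓ : Level} {X : Set a} where

  private
    variable
      d : Level
      D : Pred X d
      R : List X → Rel X ℓ
      x y : X
      c r s t : List X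

  Unique-resp-↭ : ∀ {xs ys : List X} → xs ↭ ys → Unique xs → Unique ys
  Unique-resp-↭ = PermutationSetoid.Unique-resp-↭ (setoid X) ∘ ↭⇒↭ₛ

  -- X has no decidable equality; positions in a duplicate-free list decide it.
  unique-≟ : Unique s → x ∈ s → y ∈ s → Dec (x ≡ y)
  unique-≟ (_ ∷ _)    (here x≡z) (here y≡z) = yes (trans x≡z (sym y≡z))
  unique-≟ (z≢ ∷ _)   (here x≡z) (there y∈) = no λ x≡y → All.lookup z≢ y∈ (trans (sym x≡z) x≡y)
  unique-≟ (z≢ ∷ _)   (there x∈) (here y≡z) = no λ x≡y → All.lookup z≢ x∈ (trans (sym y≡z) (sym x≡y))
  unique-≟ (_ ∷ uniq) (there x∈) (there y∈) = unique-≟ uniq x∈ y∈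

  unique-∈? : Unique s → x ∈ s → ∀ c → c ⊆ s → Dec (x ∈ c)
  unique-∈? uniq x∈s []      _   = no λ ()
  unique-∈? uniq x∈s (z ∷ c) c⊆s =
    map′ fromSum toSum
      (unique-≟ uniq x∈s (c⊆s (here refl)) ⊎-dec unique-∈? uniq x∈s c (c⊆s ∘ there))

  ++-residue-empty : ∀ {t : List X} c r → t ↭ c ++ r → length c ≡ length t → r ≡ []
  ++-residue-empty c []      _ _       = refl
  ++-residue-empty {t = t} c (z ∷ r) t↭ |c|≡|t| = ⊥-elim (m+1+n≢m (length c) (begin
    length c + suc (length r) ≡⟨ length-++ c ⟨
    length (c ++ z ∷ r)       ≡⟨ ↭-length t↭ ⟨
    length t                  ≡⟨ |c|≡|t| ⟨
    length c                  ∎))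
    where open ≡-Reasoning

  Slice : Pred X d → Rel X ℓ → X → Pred X (a ⊔ d ⊔ ℓ)
  Slice D R₀ y x = D x × Strict R₀ x y

  Chain : Pred X d → (List X → Rel X ℓ) → List X → Set (a ⊔ d ⊔ ℓ)
  Chain D R []      = Lift _ ⊤
  Chain D R (y ∷ c) = D y × Chain (Slice D (R []) y) (R ∘ (y ∷_)) c

  Below : Pred X d → (List X → Rel X ℓ) → List X → Pred X (a ⊔ d ⊔ ℓ)
  Below D R []      x = Lift (a ⊔ ℓ) (D x)
  Below D R (y ∷ c) x = Below (Slice D (R []) y) (R ∘ (y ∷_)) c x

  RestBelow : Pred X d → (List X → Rel X ℓ) → List X → List X → Set (a ⊔ d ⊔ ℓ)
  RestBelow D R s c = ∀ {x} → x ∈ s → D x → x ∉ c → Below D R c x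

  wellOrder : ∀ m → IsOS (suc m) D R → IsWellOrderOn D (R [])
  wellOrder zero os       = os
  wellOrder (suc m) (wo , _) = wo

  Chain⇒All : ∀ c → Chain D R c → All D c
  Chain⇒All []      _         = []
  Chain⇒All (y ∷ c) (Dy , ch) = Dy ∷ All.map proj₁ (Chain⇒All c ch)

  Chain⇒Unique : ∀ c → Chain D R c → Unique c
  Chain⇒Unique []      _        = []
  Chain⇒Unique (y ∷ c) (_ , ch) =
    All.map (λ (_ , _ , z≢y) → ≢-sym z≢y) (Chain⇒All c ch) ∷ Chain⇒Unique c ch

  Below⇒Dom : ∀ c → Below D R c x → D x
  Below⇒Dom []      below = lower below
  Below⇒Dom (y ∷ c) below = proj₁ (Below⇒Dom c below)

  Dom⇔Below : ∀ m → IsOS (suc m) D R → ∀ c → Chain D R c → length c ≤ m →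
              Dom (R c) x ⇔ Below D R c x
  Dom⇔Below m os [] _ _ =
    mk⇔ (lift ∘ proj₁ ∘ IsWellOrderOn.inside wo) (IsWellOrderOn.refl wo ∘ lower)
    where wo = wellOrder m os
  Dom⇔Below (suc m) (_ , sub) (y ∷ c) (Dy , ch) (s≤s |c|≤m) = Dom⇔Below m (sub y Dy) c ch |c|≤m

  module _ {R₀ : Rel X ℓ} (≼-trans : Transitive R₀)
           (≼-total : ∀ {x y} → D x → D y → R₀ x y ⊎ R₀ y x) where

    extract-max : ∀ x xs → All D (x ∷ xs) → ∃₂ λ y ys → x ∷ xs ↭ y ∷ ys × All (λ z → R₀ z y) ys
    extract-max x []       _               = x , [] , ↭-refl , []
    extract-max x (x′ ∷ xs) (Dx ∷ Dx′∷xs)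
      with y , ys , x′∷xs↭ , ys≼y ← extract-max x′ xs Dx′∷xs
      with ≼-total Dx (All.head (All-resp-↭ x′∷xs↭ Dx′∷xs))
    ... | inj₁ x≼y = y , x ∷ ys , ↭-trans (↭-prep x x′∷xs↭) (↭-swap x y ↭-refl) , x≼y ∷ ys≼y
    ... | inj₂ y≼x = x , y ∷ ys , ↭-prep x x′∷xs↭ , y≼x ∷ All.map (λ z≼y → ≼-trans z≼y y≼x) ys≼y

  Slice-of-max : ∀ {R₀ : Rel X ℓ} {ys} → All D (y ∷ ys) → Unique (y ∷ ys) → All (λ z → R₀ z y) ys →
                 All (Slice D R₀ y) ys
  Slice-of-max (_ ∷ Dys) (y∉ys ∷ _) ys≼y = All.tabulate λ z∈ys →
    All.lookup Dys z∈ys , All.lookup ys≼y z∈ys , ≢-sym (All.lookup y∉ys z∈ys)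

  greedy-chain : ∀ m → IsOS (suc m) D R → ∀ {k} → k ≤ m → k ≤ length s → Unique s → All D s →
                 ∃₂ λ c r → s ↭ c ++ r × Chain D R c × length c ≡ k × All (Below D R c) r
  greedy-chain {s = s} m os {zero} _ _ _ Ds = [] , s , ↭-refl , lift tt , refl , All.map lift Ds
  greedy-chain {R = R} {s = x ∷ xs} (suc m) (wo , sub) {suc k} (s≤s k≤m) (s≤s k≤|xs|) uniq Ds
    with y , ys , s↭ , ys≼y ← extract-max (IsWellOrderOn.trans wo) (IsWellOrderOn.total wo) x xs Ds
    with Dy ← All.head (All-resp-↭ s↭ Ds)
    with c , r , ys↭ , ch , |c|≡k , r-below ←
           greedy-chain m (sub y Dy) k≤m
             (≤-trans k≤|xs| (≤-reflexive (suc-injective (↭-length s↭))))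
             (AllPairs.tail (Unique-resp-↭ s↭ uniq))
             (Slice-of-max {R₀ = R []} (All-resp-↭ s↭ Ds) (Unique-resp-↭ s↭ uniq) ys≼y)
    = y ∷ c , r , ↭-trans s↭ (↭-prep y ys↭) , (Dy , ch) , cong suc |c|≡k , r-below

  ↭-++⇒RestBelow : s ↭ c ++ r → All (Below D R c) r → RestBelow D R s c
  ↭-++⇒RestBelow {c = c} s↭ r-below x∈s _ x∉c with ∈-++⁻ c (∈-resp-↭ s↭ x∈s)
  ... | inj₁ x∈c = ⊥-elim (x∉c x∈c)
  ... | inj₂ x∈r = All.lookup r-below x∈r

  Descent : Pred X d → (List X → Rel X ℓ) → List X → List X → Set (a ⊔ d ⊔ ℓ)
  Descent D R s c = Chain D R c × c ⊆ s × RestBelow D R s c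

  Descent-tail : Descent D R s (y ∷ c) → Descent (Slice D (R []) y) (R ∘ (y ∷_)) s c
  Descent-tail ((_ , ch) , y∷c⊆s , rb) = ch , y∷c⊆s ∘ there , λ x∈s (Dx , _ , x≢y) x∉c →
    rb x∈s Dx λ { (here x≡y) → x≢y x≡y ; (there x∈c) → x∉c x∈c }

  Descent-head-max : IsWellOrderOn D (R []) → Unique s → Descent D R s (y ∷ c) →
                     x ∈ s → D x → R [] x y
  Descent-head-max {c = c} wo uniq ((Dy , ch) , y∷c⊆s , rb) x∈s Dx with unique-∈? uniq x∈s _ y∷c⊆s
  ... | yes (here refl)  = IsWellOrderOn.refl wo Dy
  ... | yes (there x∈c) = proj₁ (proj₂ (All.lookup (Chain⇒All c ch) x∈c))
  ... | no x∉y∷c        = proj₁ (proj₂ (Below⇒Dom c (rb x∈s Dx x∉y∷c)))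

  Descent-unique : ∀ m → IsOS (suc m) D R → Unique s → ∀ c c′ → Descent D R s c → Descent D R s c′ →
                   length c ≡ length c′ → length c ≤ m → c ≡ c′
  Descent-unique _ _ _ [] [] _ _ _ _ = refl
  Descent-unique {R = R} (suc m) (wo , sub) uniq (y ∷ c) (y′ ∷ c′)
                 desc@((Dy , _) , y∷c⊆s , _) desc′@((Dy′ , _) , y′∷c′⊆s , _) |c|≡|c′| (s≤s |c|≤m)
    with refl ← IsWellOrderOn.antisym wo {y} {y′}
                  (Descent-head-max {R = R} wo uniq desc′ (y∷c⊆s (here refl)) Dy)
                  (Descent-head-max {R = R} wo uniq desc (y′∷c′⊆s (here refl)) Dy′)
    = cong (y ∷_) (Descent-unique m (sub y Dy) uniq c c′
                     (Descent-tail {R = R} desc) (Descent-tail {R = R} desc′)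
                     (suc-injective |c|≡|c′|) |c|≤m)

  descent-exists : ∀ m → IsOS (suc m) D R → ∀ {k} → k ≤ m → k ≤ length s → Unique s → All D s →
                   ∃ λ c → Descent D R s c × length c ≡ k
  descent-exists m os k≤m k≤|s| uniq Ds
    with c , r , s↭ , ch , |c|≡k , r-below ← greedy-chain m os k≤m k≤|s| uniq Ds
    = c , (ch , ∈-resp-↭ (↭-sym s↭) ∘ ∈-++⁺ˡ , ↭-++⇒RestBelow s↭ r-below) , |c|≡k

  chain-arrangement : ∀ m → IsOS (suc m) D R → length t ≤ m → Unique t → All D t →
                      ∃ λ c → t ↭ c × Chain D R c
  chain-arrangement {t = t} m os |t|≤m uniq Dt
    with c , r , t↭ , ch , |c|≡|t| , _ ← greedy-chain m os |t|≤m ≤-refl uniq Dt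
    with refl ← ++-residue-empty c r t↭ |c|≡|t|
    = c , subst (t ↭_) (++-identityʳ c) t↭ , ch

  Descent⇒Dom : ∀ m → IsOS (suc m) D R → Descent D R s c → length c ≤ m →
                x ∈ s → D x → x ∉ c → Dom (R c) x
  Descent⇒Dom m os (ch , _ , rb) |c|≤m x∈s Dx x∉c =
    Equivalence.from (Dom⇔Below m os _ ch |c|≤m) (rb x∈s Dx x∉c)

  arranged-descent : ∀ m → IsOrderingSystem (suc m) R → Unique t → t ⊆ s → length t ≤ m →
                     (∀ x → x ∈ s → x ∉ t → Dom (R t) x) → ∃ λ c → t ↭ c × Descent U R s c
  arranged-descent {t = t} m (↭-invariant , os) uniq t⊆s |t|≤m t-dom
    with c , t↭c , ch ← chain-arrangement m os |t|≤m uniq (All.universal _ t)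
    = c , t↭c , ch , t⊆s ∘ ∈-resp-↭ (↭-sym t↭c) , λ {x} x∈s _ x∉c →
        Equivalence.to (Dom⇔Below m os c ch (≤-trans (≤-reflexive (sym (↭-length t↭c))) |t|≤m))
          (↭-invariant t c uniq (s≤s |t|≤m) t↭c x x (t-dom x x∈s (x∉c ∘ ∈-resp-↭ t↭c)))

lemma2p16 : ∀ {a ℓ : Level} {X : Set a} (n : ℕ) → 0 < n →
    (R : List X → Rel X ℓ) → IsOrderingSystem n R →
    (s : List X) → Unique s →
    (k : ℕ) → k ≤ n ∸ 1 → k ≤ length s →
    Σ (List X) (λ sₖ →
      (Unique sₖ × sₖ ⊆ s × length sₖ ≡ k ×
        (∀ x → x ∈ s → x ∉ sₖ → Dom (R sₖ) x)) ×
      (∀ t → Unique t → t ⊆ s → length t ≡ k →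
        (∀ x → x ∈ s → x ∉ t → Dom (R t) x) →
        ∀ x → (x ∈ t) ⇔ (x ∈ sₖ)))
lemma2p16 (suc m) _ R isOS@(_ , os) s uniq k k≤m k≤|s|
  with c , desc@(ch , c⊆s , _) , |c|≡k ← descent-exists m os k≤m k≤|s| uniq (All.universal _ s)
  = c , (Chain⇒Unique c ch , c⊆s , |c|≡k , λ x x∈s → Descent⇒Dom m os desc |c|≤m x∈s tt) , unique
  where
    |c|≤m : length c ≤ m
    |c|≤m = ≤-trans (≤-reflexive |c|≡k) k≤m
    unique : ∀ t → Unique t → t ⊆ s → length t ≡ k →
             (∀ x → x ∈ s → x ∉ t → Dom (R t) x) → ∀ x → (x ∈ t) ⇔ (x ∈ c)
    unique t uniq-t t⊆s |t|≡k t-dom x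
      with c′ , t↭c′ , desc′ ←
             arranged-descent m isOS uniq-t t⊆s (≤-trans (≤-reflexive |t|≡k) k≤m) t-dom
      with refl ← Descent-unique m os uniq c c′ desc desc′
                    (trans |c|≡k (trans (sym |t|≡k) (↭-length t↭c′))) |c|≤m
      = mk⇔ (∈-resp-↭ t↭c′) (∈-resp-↭ (↭-sym t↭c′))
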